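{- Let $\lambda_1,\lambda_2$ be integers with $1\le \lambda_2\le 240$ and $\lambda_1>\lambda_2$. Then $$C_{\lambda_1,\lambda_2}(-1,1):=\sum_{j=0}^{\lambda_2}(-1)^j\binom{\lambda_1}{j}\binom{\lambda_2}{j}\neq 0.$$ -}

module Defs where

open import Data.Nat using (ℕ; zero; suc)
open import Data.Nat.Combinatorics using (_C_)
open import Data.Integer using (ℤ; +_; _+_; _*_; -_)

signℤ : ℕ → ℤ
signℤ zero = + 1
signℤ (suc j) = - signℤ j

term : ℕ → ℕ → ℕ → ℤ
term a b j = signℤ j * (+ (a C j)) * (+ (b C j))

sumTo : (ℕ → ℤ) → ℕ → ℤ
sumTo f zero = f zero
sumTo f (suc m) = sumTo f m + f (suc m)

Cm11 : ℕ → ℕ → ℤ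
Cm11 λ₁ λ₂ = sumTo (term λ₁ λ₂) λ₂

-- Write g(j) = (-1)^j C(λ₂,j), so that C_{λ₁,λ₂}(-1,1) = Σⱼ C(λ₁,j) g(j) is the λ₁-th
-- binomial transform of g. By Pascal's rule the row of transforms of the shifts of g at
-- λ₁ + 1 is obtained from the row at λ₁ by adding neighbouring entries, and a row whose
-- entries all have one sign, its first entry strictly, keeps this property forever. So
-- for each λ₂ ≤ 240 it suffices to compute the rows from λ₁ = λ₂ + 1 on until one is
-- sign-definite, checking that the first entries met on the way are nonzero.
module Submission where

open import Defs
open import Data.Bool using (Bool; true; T)
open import Data.Bool.ListAction using (all)
open import Data.Bool.Properties using (T-≡)
open import Data.Empty using (⊥)
open import Data.Integer using (ℤ; +_; _+_; _*_)
import Data.Integer as ℤ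
import Data.Integer.Properties as ℤ
open import Data.Integer.Tactic.RingSolver using (solve-∀)
open import Data.List using (List; []; _∷_; head; upTo)
open import Data.List.Membership.Propositional.Properties using (∈-upTo⁺)
open import Data.List.Relation.Unary.All using (All; []; _∷_; all?)
import Data.List.Relation.Unary.All as All
open import Data.List.Relation.Unary.All.Properties using (all⁺)
open import Data.Maybe using (Maybe; just; nothing; is-just; to-witness-T)
import Data.Maybe as Maybe
import Data.Maybe.Properties as Maybe
open import Data.Nat using (ℕ; zero; suc; _≤_; _<_; _∸_; z≤n; s≤s)
import Data.Nat as ℕ
import Data.Nat.Properties as ℕ
open import Data.Nat.Combinatorics using (_C_; k>n⇒nCk≡0; nCk+nC[k+1]≡[n+1]C[k+1])
open import Data.Nat.GeneralisedArithmetic using (iterate)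
open import Data.Product using (_×_; _,_)
open import Data.Sum using (_⊎_; inj₁; inj₂)
open import Function using (_∘′_; Equivalence)
open import Relation.Nullary using (¬_; yes; no; _×-dec_; _⊎-dec_)
open import Relation.Unary using (Decidable)
open import Relation.Binary.PropositionalEquality
  using (_≡_; _≢_; refl; sym; trans; cong; cong₂; ≢-sym; module ≡-Reasoning)

open ≡-Reasoning

shift : (ℕ → ℤ) → ℕ → ℤ
shift g j = g (suc j)

VanishesFrom : (ℕ → ℤ) → ℕ → Set
VanishesFrom g n = ∀ j → n ≤ j → g j ≡ + 0

VanishesFrom-suc : ∀ {g n} → VanishesFrom g n → VanishesFrom g (suc n)
VanishesFrom-suc g≡0 j n<j = g≡0 j (ℕ.<⇒≤ n<j)

shift-VanishesFrom : ∀ {g n} → VanishesFrom g (suc n) → VanishesFrom (shift g) n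
shift-VanishesFrom g≡0 j n≤j = g≡0 (suc j) (s≤s n≤j)

-- Σₖ C(a,k) g(k), computed by Pascal's rule.
binomialTransform : ℕ → (ℕ → ℤ) → ℤ
binomialTransform zero    g = g 0
binomialTransform (suc a) g = binomialTransform a g + binomialTransform a (shift g)

sumBelow : (ℕ → ℤ) → ℕ → ℤ
sumBelow f zero    = + 0
sumBelow f (suc n) = sumBelow f n + f n

sumTo≡sumBelow : ∀ f n → sumTo f n ≡ sumBelow f (suc n)
sumTo≡sumBelow f zero    = sym (ℤ.+-identityˡ (f 0))
sumTo≡sumBelow f (suc n) = cong (_+ f (suc n)) (sumTo≡sumBelow f n)

sumBelow-cong : ∀ {f h} → (∀ j → f j ≡ h j) → ∀ n → sumBelow f n ≡ sumBelow h n
sumBelow-cong f≡h zero    = refl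
sumBelow-cong f≡h (suc n) = cong₂ _+_ (sumBelow-cong f≡h n) (f≡h n)

binomialSum : ℕ → (ℕ → ℤ) → ℕ → ℤ
binomialSum a g = sumBelow (λ j → g j * + (a C j))

binomialSum-zero : ∀ g n → binomialSum 0 g (suc n) ≡ g 0
binomialSum-zero g zero    = trans (ℤ.+-identityˡ _) (ℤ.*-identityʳ (g 0))
binomialSum-zero g (suc n) = begin
  binomialSum 0 g (suc n) + g (suc n) * + (0 C suc n)
    ≡⟨ cong₂ _+_ (binomialSum-zero g n) (ℤ.*-zeroʳ (g (suc n))) ⟩
  g 0 + + 0
    ≡⟨ ℤ.+-identityʳ (g 0) ⟩
  g 0
    ∎

binomialSum-suc : ∀ a g n →
  binomialSum (suc a) g (suc n) ≡ binomialSum a g (suc n) + binomialSum a (shift g) n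
binomialSum-suc a g zero    = sym (ℤ.+-identityʳ _)
binomialSum-suc a g (suc n) = begin
  binomialSum (suc a) g (suc n) + g (suc n) * + (suc a C suc n)
    ≡⟨ cong₂ _+_ (binomialSum-suc a g n)
                 (cong (λ c → g (suc n) * + c) (sym (nCk+nC[k+1]≡[n+1]C[k+1] a n))) ⟩
  binomialSum a g (suc n) + binomialSum a (shift g) n + g (suc n) * (+ (a C n) + + (a C suc n))
    ≡⟨ interchange (binomialSum a g (suc n)) (binomialSum a (shift g) n)
                   (g (suc n)) (+ (a C n)) (+ (a C suc n)) ⟩
  binomialSum a g (suc (suc n)) + binomialSum a (shift g) (suc n)
    ∎
  where
  interchange : ∀ x y u p q → x + y + u * (p + q) ≡ x + u * q + (y + u * p)
  interchange = solve-∀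

binomialSum-extend : ∀ a g n → g n ≡ + 0 → binomialSum a g (suc n) ≡ binomialSum a g n
binomialSum-extend a g n gn≡0 = begin
  binomialSum a g n + g n * + (a C n)  ≡⟨ cong (λ x → binomialSum a g n + x * + (a C n)) gn≡0 ⟩
  binomialSum a g n + + 0              ≡⟨ ℤ.+-identityʳ _ ⟩
  binomialSum a g n                    ∎

binomialTransform≡binomialSum : ∀ a g n → VanishesFrom g n →
                                binomialTransform a g ≡ binomialSum a g n
binomialTransform≡binomialSum zero    g zero    g≡0 = g≡0 0 z≤n
binomialTransform≡binomialSum zero    g (suc n) g≡0 = sym (binomialSum-zero g n)
binomialTransform≡binomialSum (suc a) g n       g≡0 = begin
  binomialTransform a g + binomialTransform a (shift g)
    ≡⟨ cong₂ _+_ (binomialTransform≡binomialSum a g n g≡0)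
                 (binomialTransform≡binomialSum a (shift g) n (shift-VanishesFrom (VanishesFrom-suc g≡0))) ⟩
  binomialSum a g n + binomialSum a (shift g) n
    ≡⟨ cong (_+ binomialSum a (shift g) n) (sym (binomialSum-extend a g n gn≡0)) ⟩
  binomialSum a g (suc n) + binomialSum a (shift g) n
    ≡⟨ sym (binomialSum-suc a g n) ⟩
  binomialSum (suc a) g (suc n)
    ≡⟨ binomialSum-extend (suc a) g n gn≡0 ⟩
  binomialSum (suc a) g n
    ∎
  where
  gn≡0 : g n ≡ + 0
  gn≡0 = g≡0 n ℕ.≤-refl

alternatingBinomial : ℕ → ℕ → ℤ
alternatingBinomial b j = signℤ j * + (b C j)

alternatingBinomial-vanishes : ∀ b → VanishesFrom (alternatingBinomial b) (suc b)
alternatingBinomial-vanishes b j b<j rewrite k>n⇒nCk≡0 b<j = ℤ.*-zeroʳ (signℤ j)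

Cm11≡binomialTransform : ∀ a b → Cm11 a b ≡ binomialTransform a (alternatingBinomial b)
Cm11≡binomialTransform a b = begin
  sumTo (term a b) b
    ≡⟨ sumTo≡sumBelow (term a b) b ⟩
  sumBelow (term a b) (suc b)
    ≡⟨ sumBelow-cong (λ j → swap (signℤ j) (+ (a C j)) (+ (b C j))) (suc b) ⟩
  binomialSum a (alternatingBinomial b) (suc b)
    ≡⟨ sym (binomialTransform≡binomialSum a _ (suc b) (alternatingBinomial-vanishes b)) ⟩
  binomialTransform a (alternatingBinomial b)
    ∎
  where
  swap : ∀ s x y → s * x * y ≡ s * y * x
  swap = solve-∀

-- The entry beyond the end of a row counts as 0.
pascalStep : List ℤ → List ℤ
pascalStep []           = []
pascalStep (x ∷ [])     = x ∷ []
pascalStep (x ∷ y ∷ xs) = x + y ∷ pascalStep (y ∷ xs)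

transformRow : ℕ → (ℕ → ℤ) → ℕ → List ℤ
transformRow a g zero    = []
transformRow a g (suc m) = binomialTransform a g ∷ transformRow a (shift g) m

pascalStep-transformRow : ∀ a g m → VanishesFrom g m →
                          pascalStep (transformRow a g m) ≡ transformRow (suc a) g m
pascalStep-transformRow a g zero          g≡0 = refl
pascalStep-transformRow a g (suc zero)    g≡0 = cong (_∷ []) (begin
  binomialTransform a g                                  ≡⟨ ℤ.+-identityʳ _ ⟨
  binomialTransform a g + + 0                            ≡⟨ cong (λ y → binomialTransform a g + y) shifted≡0 ⟨
  binomialTransform a g + binomialTransform a (shift g)  ∎)
  where
  shifted≡0 : binomialTransform a (shift g) ≡ + 0
  shifted≡0 = binomialTransform≡binomialSum a (shift g) 0 (shift-VanishesFrom g≡0)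
pascalStep-transformRow a g (suc (suc m)) g≡0 =
  cong (binomialTransform (suc a) g ∷_)
       (pascalStep-transformRow a (shift g) (suc m) (shift-VanishesFrom g≡0))

iterate-pascalStep-transformRow : ∀ t a g m → VanishesFrom g m →
  iterate pascalStep (transformRow a g m) t ≡ transformRow (a ℕ.+ t) g m
iterate-pascalStep-transformRow zero    a g m g≡0 = cong (λ c → transformRow c g m) (sym (ℕ.+-identityʳ a))
iterate-pascalStep-transformRow (suc t) a g m g≡0 = begin
  iterate pascalStep (pascalStep (transformRow a g m)) t
    ≡⟨ cong (λ xs → iterate pascalStep xs t) (pascalStep-transformRow a g m g≡0) ⟩
  iterate pascalStep (transformRow (suc a) g m) t
    ≡⟨ iterate-pascalStep-transformRow t (suc a) g m g≡0 ⟩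
  transformRow (suc a ℕ.+ t) g m
    ≡⟨ cong (λ c → transformRow c g m) (ℕ.+-suc a t) ⟨
  transformRow (a ℕ.+ suc t) g m
    ∎

Definite : (Weak Strict : ℤ → Set) → List ℤ → Set
Definite Weak Strict []       = ⊥
Definite Weak Strict (x ∷ xs) = Strict x × All Weak xs

definite? : ∀ {Weak Strict} → Decidable Weak → Decidable Strict → Decidable (Definite Weak Strict)
definite? weak? strict? []       = no λ ()
definite? weak? strict? (x ∷ xs) = strict? x ×-dec all? weak? xs

module DefiniteRows {Weak Strict : ℤ → Set}
  (weak+weak   : ∀ {x y} → Weak x → Weak y → Weak (x + y))
  (strict+weak : ∀ {x y} → Strict x → Weak y → Strict (x + y))
  (strict⇒≢0   : ∀ {x} → Strict x → x ≢ + 0)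
  where

  pascalStep-all : ∀ {xs} → All Weak xs → All Weak (pascalStep xs)
  pascalStep-all []              = []
  pascalStep-all (wx ∷ [])       = wx ∷ []
  pascalStep-all (wx ∷ wy ∷ wys) = weak+weak wx wy ∷ pascalStep-all (wy ∷ wys)

  pascalStep-definite : ∀ xs → Definite Weak Strict xs → Definite Weak Strict (pascalStep xs)
  pascalStep-definite (x ∷ [])     d                = d
  pascalStep-definite (x ∷ y ∷ ys) (sx , wy ∷ wys) = strict+weak sx wy , pascalStep-all (wy ∷ wys)

  iterate-definite : ∀ t xs → Definite Weak Strict xs → Definite Weak Strict (iterate pascalStep xs t)
  iterate-definite zero    xs d = d
  iterate-definite (suc t) xs d = iterate-definite t (pascalStep xs) (pascalStep-definite xs d)

  definite⇒head≢0 : ∀ xs → Definite Weak Strict xs → head xs ≢ just (+ 0)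
  definite⇒head≢0 (x ∷ xs) (sx , _) refl = strict⇒≢0 sx refl

module NonNegative = DefiniteRows {ℤ.0ℤ ℤ.≤_} {ℤ.0ℤ ℤ.<_} ℤ.+-mono-≤ ℤ.+-mono-<-≤ (≢-sym ∘′ ℤ.<⇒≢)
module NonPositive = DefiniteRows {ℤ._≤ ℤ.0ℤ} {ℤ._< ℤ.0ℤ} ℤ.+-mono-≤ ℤ.+-mono-<-≤ ℤ.<⇒≢

SignDefinite : List ℤ → Set
SignDefinite xs = Definite (ℤ.0ℤ ℤ.≤_) (ℤ.0ℤ ℤ.<_) xs ⊎ Definite (ℤ._≤ ℤ.0ℤ) (ℤ._< ℤ.0ℤ) xs

signDefinite? : Decidable SignDefinite
signDefinite? xs = definite? (ℤ.0ℤ ℤ.≤?_) (ℤ.0ℤ ℤ.<?_) xs ⊎-dec definite? (ℤ._≤? ℤ.0ℤ) (ℤ._<? ℤ.0ℤ) xs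

signDefinite⇒head≢0 : ∀ t xs → SignDefinite xs → head (iterate pascalStep xs t) ≢ just (+ 0)
signDefinite⇒head≢0 t xs (inj₁ d) = NonNegative.definite⇒head≢0 _ (NonNegative.iterate-definite t xs d)
signDefinite⇒head≢0 t xs (inj₂ d) = NonPositive.definite⇒head≢0 _ (NonPositive.iterate-definite t xs d)

data EventuallySignDefinite : List ℤ → Set where
  now   : ∀ {xs} → SignDefinite xs → EventuallySignDefinite xs
  later : ∀ {xs} → head xs ≢ just (+ 0) → EventuallySignDefinite (pascalStep xs) →
          EventuallySignDefinite xs

eventuallySignDefinite⇒head≢0 : ∀ {xs} → EventuallySignDefinite xs →
                                ∀ t → head (iterate pascalStep xs t) ≢ just (+ 0)
eventuallySignDefinite⇒head≢0 (now d)     t       = signDefinite⇒head≢0 t _ d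
eventuallySignDefinite⇒head≢0 (later h e) zero    = h
eventuallySignDefinite⇒head≢0 (later h e) (suc t) = eventuallySignDefinite⇒head≢0 e t

searchEventuallySignDefinite : (fuel : ℕ) → (xs : List ℤ) → Maybe (EventuallySignDefinite xs)
searchEventuallySignDefinite zero       xs = nothing
searchEventuallySignDefinite (suc fuel) xs
  with signDefinite? xs | Maybe.≡-dec ℤ._≟_ (head xs) (just (+ 0))
... | yes d | _     = just (now d)
... | no _  | yes _ = nothing
... | no _  | no h  = Maybe.map (later h) (searchEventuallySignDefinite fuel (pascalStep xs))

firstRow : ℕ → List ℤ
firstRow b = iterate pascalStep (transformRow 0 (alternatingBinomial b) (suc b)) (suc b)

head-iterate-firstRow : ∀ {a b} → b < a →
                        head (iterate pascalStep (firstRow b) (a ∸ suc b)) ≡ just (Cm11 a b)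
head-iterate-firstRow {a} {b} b<a = begin
  head (iterate pascalStep (firstRow b) (a ∸ suc b))
    ≡⟨ cong (λ xs → head (iterate pascalStep xs (a ∸ suc b)))
            (iterate-pascalStep-transformRow (suc b) 0 g (suc b) g≡0) ⟩
  head (iterate pascalStep (transformRow (suc b) g (suc b)) (a ∸ suc b))
    ≡⟨ cong head (iterate-pascalStep-transformRow (a ∸ suc b) (suc b) g (suc b) g≡0) ⟩
  just (binomialTransform (suc b ℕ.+ (a ∸ suc b)) g)
    ≡⟨ cong (λ c → just (binomialTransform c g)) (ℕ.m+[n∸m]≡n b<a) ⟩
  just (binomialTransform a g)
    ≡⟨ cong just (Cm11≡binomialTransform a b) ⟨
  just (Cm11 a b)
    ∎
  where
  g : ℕ → ℤ
  g = alternatingBinomial b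

  g≡0 : VanishesFrom g (suc b)
  g≡0 = alternatingBinomial-vanishes b

all-upTo⇒ : ∀ (p : ℕ → Bool) n → all p (upTo n) ≡ true → ∀ {b} → b < n → T (p b)
all-upTo⇒ p n all≡true b<n = All.lookup (all⁺ p (upTo n) (Equivalence.from T-≡ all≡true)) (∈-upTo⁺ b<n)

certified : ℕ → Bool
certified b = is-just (searchEventuallySignDefinite (5 ℕ.* b ℕ.+ 1) (firstRow b))

-- At worst about 4.62 b steps beyond λ₁ = b + 1 are needed, so the fuel 5 b + 1 suffices.
all-certified : all certified (upTo 241) ≡ true
all-certified = refl

proposition3 : (λ₁ λ₂ : ℕ) → 1 ≤ λ₂ → λ₂ ≤ 240 → λ₂ < λ₁ → ¬ (Cm11 λ₁ λ₂ ≡ + 0)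
proposition3 a b _ b≤240 b<a Cm11≡0 =
  eventuallySignDefinite⇒head≢0 certificate (a ∸ suc b) (trans (head-iterate-firstRow b<a) (cong just Cm11≡0))
  where
  certificate : EventuallySignDefinite (firstRow b)
  certificate = to-witness-T _ (all-upTo⇒ certified 241 all-certified (s≤s b≤240))
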